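{- Let $\mathcal{M}_1,\dots,\mathcal{M}_n$ be compatible interface transition systems and $\mathcal{C}=\mathcal{M}_1\otimes\dots\otimes\mathcal{M}_n$ their asynchronous composition. Then for every $1\le i\le n$: $\{Pr_i(\pi)\mid \pi\in\mathcal{L}(\mathcal{C})\}\subseteq\mathcal{L}(\mathcal{M}_i)$.
   Context: Traces: given disjoint sets of input variables $V^I$ and output variables $V^O$, a trace over $(V^I,V^O)$ is a nonempty finite or infinite sequence $\pi=s_0s_1\cdots$ of assignments to $V^I\cup V^O$, except that if $\pi$ is finite its last assignment is defined only on $V^O$; $|\pi|$ is its length. For an assignment $s$ and a set $U$ of variables, $s|_U$ is its restriction to $U$. An interface transition system (ITS) $\mathcal{M}=\langle V^I,V^O,\mathcal I,\mathcal T,\mathcal{SF}\rangle$ consists of disjoint sets $V^I$ (inputs) and $V^O$ (outputs), $V:=V^I\cup V^O$, an initial condition $\mathcal I$ (first-order formula over $V^O$), a transition condition $\mathcal T$ (first-order formula over $V\cup\{v':v\in V^O\}$, primed copies denoting next values), and a set $\mathcal{SF}$ of pairs $\langle f_A,f_G\rangle$ of formulas over $V$ (strong fairness). A trace of $\mathcal M$ is a trace $\pi=s_0s_1\cdots$ over $(V^I,V^O)$ with $s_0\models\mathcal I$, $s_k\cup s'_{k+1}\models\mathcal T$ for all $k<|\pi|-1$ (where $s'_{k+1}$ gives $v'$ the value $s_{k+1}(v)$), and, if $\pi$ is infinite, for each $\langle f_A,f_G\rangle\in\mathcal{SF}$: if $f_A$ holds at infinitely many positions then $f_G$ holds at infinitely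 many positions. $\mathcal L(\mathcal M)$ is the set of all finite and infinite traces of $\mathcal M$. ITSs $\mathcal M_1,\dots,\mathcal M_n$ are compatible if for all $i\ne j$, $V_i\cap V_j=(V^O_i\cap V^I_j)\cup(V^I_i\cap V^O_j)$. Asynchronous composition: for compatible $\mathcal M_1,\dots,\mathcal M_n$ and fresh Boolean variables $run_1,\dots,run_n,end_1,\dots,end_n$, $\mathcal M_1\otimes\dots\otimes\mathcal M_n=\langle V^I,V^O,\bigwedge_j\mathcal I_j,\mathcal T,\mathcal{SF}\rangle$ where, with $W:=\bigcup_{j<k}(V_j\cap V_k)$: $V^I=\big(\bigcup_j(V^I_j\cup\{run_j\})\big)\setminus W$, $V^O=\bigcup_j(V^O_j\cup\{end_j\})\cup W$, $\mathcal T=\bigwedge_j\big((run_j\to\mathcal T_j)\wedge(\neg run_j\to\bigwedge_{v\in V^O_j}v=v')\wedge(end_j\leftrightarrow(end_j'\wedge\neg run_j))\big)$, $\mathcal{SF}=\bigcup_j\big(\{\langle\top,run_j\vee end_j\rangle\}\cup\{\langle run_j\wedge f_A,run_j\wedge f_G\rangle:\langle f_A,f_G\rangle\in\mathcal{SF}_j\}\big)$. Projection: fix $i$. For a trace $\pi=s_0s_1\cdots$ of $\mathcal C$ let $r_0<r_1<\cdots$ enumerate the positions at which $run_i$ is true. If there are infinitely many, $Pr_i(\pi):=s_{r_0}|_{V_i}\,s_{r_1}|_{V_i}\cdots$. Otherwise, with $N\ge0$ such positions, let $m:=r_{N-1}+1$ ($m:=0$ if $N=0$) and $Pr_i(\pi):=s_{r_0}|_{V_i}\cdots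 s_{r_{N-1}}|_{V_i}\,s_m|_{V^O_i}$ (a finite trace of length $N+1$ over $(V^I_i,V^O_i)$). -}

module Defs where

open import Data.Nat using (ℕ; zero; suc; _≤_; _<_; _<ᵇ_)
open import Data.Fin as Fin using (Fin)
open import Data.Bool using (Bool; true; false; if_then_else_)
open import Data.Product using (Σ; ∃; _×_; _,_)
open import Data.Sum using (_⊎_; inj₁; inj₂)
open import Data.Unit using (⊤)
open import Data.Empty using (⊥)
open import Relation.Nullary using (¬_)
open import Relation.Binary.PropositionalEquality using (_≡_; _≢_)

-- A universe of variables X with a type of values Ty x for each variable
-- (the interpretation domain of the first-order signature).  Assignments
-- are total; a "formula over U" is represented semantically as a predicate
-- on assignments, and "being a formula over U" is the locality condition
-- that it only depends on the values of the variables in U (see WellFormed).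

Assign : (X : Set) → (X → Set) → Set
Assign X Ty = (x : X) → Ty x

Agree : {X : Set} {Ty : X → Set} → (X → Set) → Assign X Ty → Assign X Ty → Set
Agree U s t = ∀ v → U v → s v ≡ t v

record ITS (X : Set) (Ty : X → Set) : Set₁ where
  field
    VI VO : X → Set
    I     : Assign X Ty → Set
    T     : Assign X Ty → Assign X Ty → Set
      -- T s t : s gives the unprimed variables, t v gives v' (v ∈ V^O)
    SF    : Set                         -- index set of the strong-fairness pairs
    fA fG : SF → Assign X Ty → Set
  V : X → Set
  V v = VI v ⊎ VO v

record WellFormed {X : Set} {Ty : X → Set} (M : ITS X Ty) : Set where
  open ITS M
  field
    disjoint : ∀ v → VI v → VO v → ⊥
    I-local  : ∀ s t → Agree VO s t → I s → I t
    T-local  : ∀ s s′ t t′ → Agree V s s′ → Agree VO t t′ → T s t → T s′ t′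
    fA-local : ∀ f s t → Agree V s t → fA f s → fA f t
    fG-local : ∀ f s t → Agree V s t → fG f s → fG f t

-- Traces: nonempty, finite or infinite.
-- fin n : finite trace of length n+1 (positions 0..n); inf : infinite.
-- The values of the last assignment of a finite trace at input variables,
-- and the values at positions beyond the length, are irrelevant.

data Len : Set where
  fin : ℕ → Len
  inf : Len

record Trace (X : Set) (Ty : X → Set) : Set where
  constructor trace
  field
    len : Len
    st  : ℕ → Assign X Ty

IsPos : {X : Set} {Ty : X → Set} → Trace X Ty → ℕ → Set
IsPos (trace (fin n) _) k = k ≤ n
IsPos (trace inf _) k = ⊤

IsStep : {X : Set} {Ty : X → Set} → Trace X Ty → ℕ → Set
IsStep π k = IsPos π (suc k)

InfOften : {X : Set} {Ty : X → Set} → (Assign X Ty → Set) → Trace X Ty → Set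
InfOften P π = ∀ m → ∃ λ k → m ≤ k × P (Trace.st π k)

record InL {X : Set} {Ty : X → Set} (M : ITS X Ty) (π : Trace X Ty) : Set where
  open ITS M
  open Trace π
  field
    init  : I (st 0)
    trans : ∀ k → IsStep π k → T (st k) (st (suc k))
    fair  : len ≡ inf → ∀ f → InfOften (fA f) π → InfOften (fG f) π

Compatible : {X : Set} {Ty : X → Set} {n : ℕ} → (Fin n → ITS X Ty) → Set
Compatible {X} M = ∀ i j → i ≢ j → ∀ (v : X) →
  ((V i v × V j v) → ((VO i v × VI j v) ⊎ (VI i v × VO j v)))
  × (((VO i v × VI j v) ⊎ (VI i v × VO j v)) → (V i v × V j v))
  where
  V VI VO : _ → X → Set
  V i = ITS.V (M i)
  VI i = ITS.VI (M i)
  VO i = ITS.VO (M i)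

-- Variables of the composition: the component variables (inj₁ v) and the
-- fresh Boolean variables run_j = inj₂ (inj₁ j), end_j = inj₂ (inj₂ j).

CVar : Set → ℕ → Set
CVar X n = X ⊎ (Fin n ⊎ Fin n)

CTy : {X : Set} (Ty : X → Set) {n : ℕ} → CVar X n → Set
CTy Ty (inj₁ v) = Ty v
CTy Ty (inj₂ _) = Bool

run : {X : Set} {n : ℕ} → Fin n → CVar X n
run j = inj₂ (inj₁ j)

end : {X : Set} {n : ℕ} → Fin n → CVar X n
end j = inj₂ (inj₂ j)

res : {X : Set} {Ty : X → Set} {n : ℕ} → Assign (CVar X n) (CTy Ty) → Assign X Ty
res s v = s (inj₁ v)

compose : {X : Set} {Ty : X → Set} {n : ℕ} → (Fin n → ITS X Ty) → ITS (CVar X n) (CTy Ty)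
compose {X} {Ty} {n} M = record
  { VI = CVI ; VO = CVO ; I = CI ; T = CT ; SF = CSF ; fA = CfA ; fG = CfG }
  where
  module C (j : Fin n) = ITS (M j)
  W : X → Set
  W v = Σ (Fin n) λ j → Σ (Fin n) λ k → (j Fin.< k) × C.V j v × C.V k v
  CVI : CVar X n → Set
  CVI (inj₁ v) = (Σ (Fin n) λ j → C.VI j v) × ¬ W v
  CVI (inj₂ (inj₁ j)) = ⊤
  CVI (inj₂ (inj₂ j)) = ⊥
  CVO : CVar X n → Set
  CVO (inj₁ v) = (Σ (Fin n) λ j → C.VO j v) ⊎ W v
  CVO (inj₂ (inj₁ j)) = ⊥
  CVO (inj₂ (inj₂ j)) = ⊤
  CA = Assign (CVar X n) (CTy Ty)
  CI : CA → Set
  CI s = ∀ j → C.I j (res s)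
  CT : CA → CA → Set
  CT s t = ∀ j →
      (s (run j) ≡ true → C.T j (res s) (res t))
    × (s (run j) ≡ false → ∀ v → C.VO j v → s (inj₁ v) ≡ t (inj₁ v))
    × ((s (end j) ≡ true → (t (end j) ≡ true × s (run j) ≡ false))
       × ((t (end j) ≡ true × s (run j) ≡ false) → s (end j) ≡ true))
  CSF : Set
  CSF = Σ (Fin n) λ j → ⊤ ⊎ C.SF j
  CfA CfG : CSF → CA → Set
  CfA (j , inj₁ _) s = ⊤
  CfA (j , inj₂ f) s = s (run j) ≡ true × C.fA j f (res s)
  CfG (j , inj₁ _) s = s (run j) ≡ true ⊎ s (end j) ≡ true
  CfG (j , inj₂ f) s = s (run j) ≡ true × C.fG j f (res s)

-- Positions of π at which run_i is true.  run_i is an input variable of the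
-- composition, so the last assignment of a finite trace does not define it;
-- hence only non-last positions count.

RunPos : {X : Set} {Ty : X → Set} {n : ℕ} → Fin n →
         Trace (CVar X n) (CTy Ty) → ℕ → Set
RunPos i π k = IsStep π k × Trace.st π k (run i) ≡ true

record EnumInf (R : ℕ → Set) (r : ℕ → ℕ) : Set where
  field
    incr     : ∀ j → r j < r (suc j)
    sound    : ∀ j → R (r j)
    complete : ∀ k → R k → ∃ λ j → r j ≡ k

record EnumFin (R : ℕ → Set) (N : ℕ) (r : ℕ → ℕ) : Set where
  field
    incr     : ∀ j → suc j < N → r j < r (suc j)
    sound    : ∀ j → j < N → R (r j)
    complete : ∀ k → R k → ∃ λ j → j < N × r j ≡ k

-- Pr_i(π) when run_i holds infinitely often, enumerated by r
projInf : {X : Set} {Ty : X → Set} {n : ℕ} →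
          Trace (CVar X n) (CTy Ty) → (ℕ → ℕ) → Trace X Ty
projInf π r = trace inf (λ j → res (Trace.st π (r j)))

lastPos : ℕ → (ℕ → ℕ) → ℕ
lastPos zero r = 0
lastPos (suc N) r = suc (r N)

-- Pr_i(π) when run_i holds at exactly N positions r_0 < ... < r_{N-1}:
-- the finite trace s_{r_0} ... s_{r_{N-1}} s_m of length N+1
projFin : {X : Set} {Ty : X → Set} {n : ℕ} →
          Trace (CVar X n) (CTy Ty) → ℕ → (ℕ → ℕ) → Trace X Ty
projFin π N r = trace (fin N)
  (λ j → res (Trace.st π (if j <ᵇ N then r j else lastPos N r)))

-- Between two consecutive positions at which run_i holds, the composition leaves the outputs
-- of M_i untouched, so by locality of T_i the step taken at r_j carries the projected state at
-- r_j to the one at r_{j+1} (or, for a finite projection, to the one at r_{N-1}+1); likewise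
-- the outputs at r_0 are those at 0, where I_i holds.  Strong fairness of M_i follows from the
-- composed pair ⟨run_i ∧ f_A , run_i ∧ f_G⟩, since every position at which run_i holds is some
-- r_j.
module Submission where

open import Defs
open import Data.Nat
  using (ℕ; zero; suc; _≤_; _<_; _<ᵇ_; z≤n; s≤s; _≤′_; ≤′-refl; ≤′-step)
open import Data.Nat.Properties
open import Data.Fin using (Fin)
open import Data.Bool using (true; false; if_then_else_)
open import Data.Bool.Properties using (¬-not)
open import Data.Product using (_×_; _,_; proj₁; proj₂)
open import Data.Sum using (inj₁; inj₂)
open import Data.Unit using (tt)
open import Data.Empty using (⊥-elim)
open import Relation.Nullary using (¬_)
open import Relation.Binary.PropositionalEquality

module _ {r : ℕ → ℕ} {N : ℕ} (incr : ∀ j → suc j < N → r j < r (suc j)) where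

  increasing-mono : ∀ {a b} → a ≤′ b → b < N → r a ≤ r b
  increasing-mono ≤′-refl        _     = ≤-refl
  increasing-mono (≤′-step {b} p) sb<N =
    ≤-trans (increasing-mono p (<-trans (n<1+n b) sb<N)) (<⇒≤ (incr b sb<N))

  increasing-cancel-< : ∀ {a b} → a < N → r a < r b → a < b
  increasing-cancel-< a<N ra<rb =
    ≰⇒> (λ b≤a → <⇒≱ ra<rb (increasing-mono (≤⇒≤′ b≤a) a<N))

increasing⇒inflationary : {r : ℕ → ℕ} → (∀ j → r j < r (suc j)) → ∀ j → j ≤ r j
increasing⇒inflationary incr zero    = z≤n
increasing⇒inflationary incr (suc j) = ≤-<-trans (increasing⇒inflationary incr j) (incr j)

module _ {R : ℕ → Set} {r : ℕ → ℕ} where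

  enumInf-cancel-< : EnumInf R r → ∀ {a b} → r a < r b → a < b
  enumInf-cancel-< E {a} = increasing-cancel-< (λ j _ → EnumInf.incr E j) (n<1+n a)

  enumInf-before : EnumInf R r → ∀ {k} → k < r 0 → ¬ R k
  enumInf-before E {k} k<r₀ Rk with EnumInf.complete E k Rk
  ... | j , refl = n≮0 (enumInf-cancel-< E k<r₀)

  enumInf-gap : EnumInf R r → ∀ j {k} → r j < k → k < r (suc j) → ¬ R k
  enumInf-gap E j {k} rj<k k<rsj Rk with EnumInf.complete E k Rk
  ... | j′ , refl = <⇒≱ (enumInf-cancel-< E rj<k) (≤-pred (enumInf-cancel-< E k<rsj))

  enumFin-before : ∀ {N} → EnumFin R N r → ∀ {k} → k < r 0 → ¬ R k
  enumFin-before E {k} k<r₀ Rk with EnumFin.complete E k Rk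
  ... | j , j<N , refl = n≮0 (increasing-cancel-< (EnumFin.incr E) j<N k<r₀)

  enumFin-gap : ∀ {N} → EnumFin R N r → ∀ {j k} → suc j < N →
                r j < k → k < r (suc j) → ¬ R k
  enumFin-gap E {j} {k} sj<N rj<k k<rsj Rk with EnumFin.complete E k Rk
  ... | j′ , j′<N , refl =
    <⇒≱ (cancel (<-trans (n<1+n j) sj<N) rj<k) (≤-pred (cancel j′<N k<rsj))
    where cancel = increasing-cancel-< (EnumFin.incr E)

module _ {X : Set} {Ty : X → Set} where

  IsPos-≤ : (π : Trace X Ty) → ∀ {j k} → j ≤ k → IsPos π k → IsPos π j
  IsPos-≤ (trace (fin n) _) j≤k k≤n = ≤-trans j≤k k≤n
  IsPos-≤ (trace inf _)     _   _   = tt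

  IsStep⇒IsPos : (π : Trace X Ty) → ∀ {k} → IsStep π k → IsPos π k
  IsStep⇒IsPos π = IsPos-≤ π (n≤1+n _)

  inf⇒IsPos : (π : Trace X Ty) → Trace.len π ≡ inf → ∀ k → IsPos π k
  inf⇒IsPos (trace inf _) refl k = tt

  increasing-steps⇒inf : (π : Trace X Ty) {r : ℕ → ℕ} → (∀ j → r j < r (suc j)) →
                         (∀ j → IsStep π (r j)) → Trace.len π ≡ inf
  increasing-steps⇒inf (trace inf _)     _    _     = refl
  increasing-steps⇒inf (trace (fin n) _) incr steps =
    ⊥-elim (<⇒≱ (steps n) (increasing⇒inflationary incr n))

projIndex : ℕ → (ℕ → ℕ) → ℕ → ℕ
projIndex N r j = if j <ᵇ N then r j else lastPos N r

projIndex-< : ∀ {N r j} → j < N → projIndex N r j ≡ r j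
projIndex-< {N} {r} {j} j<N with j <ᵇ N | <⇒<ᵇ j<N
... | true | _ = refl

projIndex-last : ∀ N r → projIndex N r N ≡ lastPos N r
projIndex-last N r with N <ᵇ N | <ᵇ⇒< N N
... | true  | N<N = ⊥-elim (n≮n N (N<N tt))
... | false | _   = refl

module Projection {X : Set} {Ty : X → Set} {n : ℕ} (M : Fin n → ITS X Ty) (i : Fin n)
  (wf : WellFormed (M i)) (π : Trace (CVar X n) (CTy Ty)) (π∈C : InL (compose M) π) where

  open ITS (M i)
  open Trace π
  module Wf = WellFormed wf
  module C = InL π∈C

  Idle : ℕ → ℕ → Set
  Idle a b = ∀ k → a ≤ k → k < b → ¬ RunPos i π k

  idle-step-preserves-outputs : ∀ k → IsStep π k → ¬ RunPos i π k →
                                Agree VO (res (st k)) (res (st (suc k)))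
  idle-step-preserves-outputs k step idle =
    proj₁ (proj₂ (C.trans k step i)) (¬-not (λ running → idle (step , running)))

  idle-preserves-outputs : ∀ {a b} → a ≤′ b → IsPos π b → Idle a b →
                           Agree VO (res (st a)) (res (st b))
  idle-preserves-outputs ≤′-refl         _   _    _ _    = refl
  idle-preserves-outputs (≤′-step {b} p) pos idle v v∈VO =
    trans (idle-preserves-outputs p (IsPos-≤ π (n≤1+n b) pos)
             (λ k a≤k k<b → idle k a≤k (<-trans k<b (n<1+n b))) v v∈VO)
          (idle-step-preserves-outputs b pos (idle b (≤′⇒≤ p) (n<1+n b)) v v∈VO)

  running-step : ∀ {a} → RunPos i π a → T (res (st a)) (res (st (suc a)))
  running-step (step , running) = proj₁ (C.trans _ step i) running

  transition-to-next-run : ∀ {a b} → RunPos i π a → a < b → IsPos π b → Idle (suc a) b →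
                           T (res (st a)) (res (st b))
  transition-to-next-run run-a a<b pos idle =
    Wf.T-local _ _ _ _ (λ _ _ → refl) (idle-preserves-outputs (≤⇒≤′ a<b) pos idle)
      (running-step run-a)

  initial-at-first-run : ∀ {b} → IsPos π b → Idle 0 b → I (res (st b))
  initial-at-first-run pos idle =
    Wf.I-local _ _ (idle-preserves-outputs (≤⇒≤′ z≤n) pos idle) (C.init i)

  module _ {r : ℕ → ℕ} (E : EnumInf (RunPos i π) r) where
    open EnumInf E

    run-IsPos : ∀ j → IsPos π (r j)
    run-IsPos j = IsStep⇒IsPos π (proj₁ (sound j))

    π-inf : len ≡ inf
    π-inf = increasing-steps⇒inf π incr (λ j → proj₁ (sound j))

    running-fA-often : ∀ f → InfOften (fA f) (projInf π r) →
                       InfOften (λ s → s (run i) ≡ true × fA f (res s)) π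
    running-fA-often f fA-often m with fA-often m
    ... | j , m≤j , fA-j =
      r j , ≤-trans m≤j (increasing⇒inflationary incr j) , proj₂ (sound j) , fA-j

    projInf-fair : ∀ f → InfOften (fA f) (projInf π r) → InfOften (fG f) (projInf π r)
    projInf-fair f fA-often m with C.fair π-inf (i , inj₂ f) (running-fA-often f fA-often) (r m)
    ... | k , rm≤k , running , fG-k with complete k (inf⇒IsPos π π-inf (suc k) , running)
    ... | j , refl =
      j , ≤-pred (enumInf-cancel-< E (≤-<-trans rm≤k (incr j))) , fG-k

    projInf∈L : InL (M i) (projInf π r)
    projInf∈L = record
      { init  = initial-at-first-run (run-IsPos 0) (λ k _ k<r₀ → enumInf-before E k<r₀)
      ; trans = λ j _ → transition-to-next-run (sound j) (incr j) (run-IsPos (suc j))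
                          (λ k rj<k k<rsj → enumInf-gap E j rj<k k<rsj)
      ; fair  = λ _ → projInf-fair
      }

  projFin-init : ∀ N {r} → EnumFin (RunPos i π) N r → I (res (st (projIndex N r 0)))
  projFin-init zero    E = C.init i
  projFin-init (suc N) E =
    initial-at-first-run (IsStep⇒IsPos π (proj₁ (EnumFin.sound E 0 (s≤s z≤n))))
      (λ k _ k<r₀ → enumFin-before E k<r₀)

  module _ {N : ℕ} {r : ℕ → ℕ} (E : EnumFin (RunPos i π) N r) where
    open EnumFin E

    projFin-trans : ∀ j → suc j ≤ N →
                    T (res (st (projIndex N r j))) (res (st (projIndex N r (suc j))))
    projFin-trans j j<N rewrite projIndex-< {N} {r} j<N with m≤n⇒m<n∨m≡n j<N
    ... | inj₁ sj<N rewrite projIndex-< {N} {r} sj<N =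
      transition-to-next-run (sound j j<N) (incr j sj<N)
        (IsStep⇒IsPos π (proj₁ (sound (suc j) sj<N)))
        (λ k rj<k k<rsj → enumFin-gap E sj<N rj<k k<rsj)
    ... | inj₂ refl rewrite projIndex-last N r = running-step (sound j j<N)

    projFin∈L : InL (M i) (projFin π N r)
    projFin∈L = record { init = projFin-init N E ; trans = projFin-trans ; fair = λ () }

theorem4p8 : {X : Set} {Ty : X → Set} (n : ℕ) (M : Fin n → ITS X Ty) →
    (∀ j → WellFormed (M j)) → Compatible M →
    ∀ (i : Fin n) (π : Trace (CVar X n) (CTy Ty)) → InL (compose M) π →
      ((r : ℕ → ℕ) → EnumInf (RunPos i π) r → InL (M i) (projInf π r))
      × ((N : ℕ) (r : ℕ → ℕ) → EnumFin (RunPos i π) N r → InL (M i) (projFin π N r))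
theorem4p8 n M wf _ i π π∈C =
  (λ _ E → projInf∈L E) , (λ _ _ E → projFin∈L E)
  where open Projection M i (wf i) π π∈C
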